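{- For every $n\geq 1$, $s_n=h_{L_n}$, where $L_n=d_1+\cdots+d_n$. Moreover, $\mathbf{s}=\lim_{n\to\infty}s_n$.
   Context: Fix $k\geq 2$ and the alphabet $\mathcal{A}_k=\{a_1,\dots,a_k\}$. An infinite word $\mathbf{t}$ is standard episturmian with directive word $x_1x_2x_3\cdots$ if its palindromic prefixes $u_1=\varepsilon,u_2,\dots$ satisfy $u_{n+1}=(u_nx_n)^{(+)}$, where $w^{(+)}$ is the shortest palindrome having $w$ as a prefix, and $\mathbf{t}=\lim_n u_n$. Let $(d_i)_{i\geq1}$ be positive integers and let $\mathbf{s}$ be the standard episturmian word with directive word $\Delta=x_1x_2x_3\cdots=a_1^{d_1}a_2^{d_2}\cdots a_k^{d_k}a_1^{d_{k+1}}\cdots a_k^{d_{2k}}a_1^{d_{2k+1}}\cdots$. Define $s_{1-k}=a_2,\dots,s_{ -1}=a_k,s_0=a_1$; $s_n=s_{n-1}^{d_n}\cdots s_0^{d_1}a_{n+1}$ for $1\leq n\leq k-1$; $s_n=s_{n-1}^{d_n}\cdots s_{n-k+1}^{d_{n-k+2}}s_{n-k}$ for $n\geq k$. For a letter $a$, $\Psi_a$ is the morphism with $\Psi_a(a)=a$ and $\Psi_a(x)=ax$ for letters $x\neq a$. Let $\mu_0=\mathrm{Id}$, $\mu_n=\Psi_{x_1}\Psi_{x_2}\cdots\Psi_{x_n}$, and $h_n=\mu_n(x_{n+1})$ for $n\geq 0$. -}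

module Defs where

open import Data.Nat using (ℕ; zero; suc; _+_; _∸_; _<_; _≤_; _<ᵇ_; NonZero)
open import Data.Nat.DivMod using (_mod_)
open import Data.Fin using (Fin; fromℕ<)
open import Data.Fin.Properties using (_≟_)
open import Data.Bool using (if_then_else_)
open import Data.List using (List; []; _∷_; _++_; [_]; reverse; length; lookup; concat; concatMap; replicate)
open import Data.Product using (Σ; ∃; _×_; _,_; proj₁)
open import Relation.Nullary using (yes; no)
open import Relation.Binary.PropositionalEquality using (_≡_)

Prefix : {A : Set} → List A → List A → Set
Prefix {A} w p = Σ (List A) (λ r → w ++ r ≡ p)

Palindrome : {A : Set} → List A → Set
Palindrome p = reverse p ≡ p

IsPalClosure : {A : Set} → List A → List A → Set
IsPalClosure w p =
  Palindrome p × Prefix w p ×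
  (∀ q → Palindrome q → Prefix w q → length p ≤ length q)

IsLimit : {A : Set} → (ℕ → List A) → (ℕ → A) → Set
IsLimit w t = ∀ i → ∃ λ N → ∀ n → N ≤ n →
  Σ (i < length (w n)) (λ p → lookup (w n) (fromℕ< p) ≡ t i)

-- Alphabet A_k = Fin k, with a_j represented by the index j - 1.
module Episturmian (k : ℕ) {{nz : NonZero k}} (d : ℕ → ℕ) where
  -- d i is d_i for i ≥ 1 (d 0 is unused)

  Word : Set
  Word = List (Fin k)

  -- letter of block b ≥ 1 of the directive word: a_{((b-1) mod k)+1}
  blockLetter : ℕ → Fin k
  blockLetter b = (b ∸ 1) mod k

  -- state (b , c) after reading m letters of Δ: currently in block b,
  -- with c letters of that block already read
  state : ℕ → ℕ × ℕ
  state zero = (1 , 0)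
  state (suc m) with state m
  ... | (b , c) = if suc c <ᵇ d b then (b , suc c) else (suc b , 0)

  -- x m = x_m for m ≥ 1 (the m-th letter of Δ)
  x : ℕ → Fin k
  x m = blockLetter (proj₁ (state (m ∸ 1)))

  L : ℕ → ℕ
  L zero = 0
  L (suc n) = L n + d (suc n)

  Ψ : Fin k → Word → Word
  Ψ a = concatMap (λ y → f y)
    where
    f : Fin k → Word
    f y with y ≟ a
    ... | yes _ = a ∷ []
    ... | no _ = a ∷ y ∷ []

  μ : ℕ → Word → Word
  μ zero w = w
  μ (suc n) w = μ n (Ψ (x (suc n)) w)

  h : ℕ → Word
  h n = μ n (x (suc n) ∷ [])

  powers : ℕ → List Word → ℕ → Word
  powers e (w ∷ ws) (suc c) = concat (replicate (d e) w) ++ powers (e ∸ 1) ws c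
  powers _ _ _ = []

  nth : List Word → ℕ → Word
  nth [] _ = []
  nth (w ∷ ws) zero = w
  nth (w ∷ ws) (suc i) = nth ws i

  -- hist n = [s_n , s_{n-1} , ... , s_{1-k}]
  hist : ℕ → List Word
  hist zero = go k
    where
    -- s_{-i} = a_{k+1-i} (i = 1..k-1), s_0 = a_1 ; as indices: (k - i) mod k
    go : ℕ → List Word
    go zero = []
    go (suc i) = ((k ∸ (k ∸ suc i)) mod k ∷ []) ∷ go i
  hist (suc m) = new ∷ hist m
    where
    n = suc m
    new : Word
    new = if n <ᵇ k
          then powers n (hist m) n ++ (n mod k ∷ [])
          else powers n (hist m) (k ∸ 1) ++ nth (hist m) (k ∸ 1)

  s : ℕ → Word
  s n = nth (hist n) 0

module Submission where

-- Proposition 3.2.  Letters a_{j+1} are the indices j : Fin k, so block n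
-- (n ≥ 0) of the directive word Δ consists of d_{n+1} copies of n mod k.
--
-- Reading a block of Δ made of the letter c leaves
-- μ(c) unchanged and prepends copies of μ(c) to μ(b) for b ≠ c.  Hence the
-- words g_n(j) = μ_{L_n}(a_{(j+n) mod k}) satisfy
--   g_{n+1}(j) = g_n(0)^{d_{n+1}} g_n(j+1)  (j + 1 < k),   g_{n+1}(k−1) = g_n(0),
-- and unrolling these recurrences reproduces the recursive definition of s_n,
-- so s_n = g_n(0) = μ_{L_n}(x_{L_n+1}) = h_{L_n}.
--
-- For a palindromic-closure sequence v_{n+1} = (v_n y_n)^(+)
-- we prove the two closure formulas (v_n y_n v_n for a new letter, v_n z for a
-- repeated one, where v_n = v_m z and m is the last occurrence), and from them
-- Justin's formula μ_n(y_n) v_n = v_{n+1}.  So s_n = h_{L_n} is a prefix of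
-- u_{L_n+1}; as the u_n form a prefix chain with |u_{n+1}| ≥ n and |s_n| > n,
-- both sequences converge to the same infinite word.

open import Defs
open import Data.Nat using (ℕ; NonZero; zero; suc; _+_; _∸_; _≤_; _<_; _≤′_; ≤′-reflexive; ≤′-step; _<ᵇ_; _%_; z≤n; s≤s; s≤s⁻¹)
open import Data.Nat.Properties hiding (_≟_)
open import Data.Nat.DivMod using (_mod_; [m+n]%n≡m%n; %-distribˡ-+; m<n⇒m%n≡m; m%n<n; m≤n⇒[n∸m]%m≡n%m; n%n≡0)
open import Data.Fin using (Fin; toℕ; fromℕ<)
open import Data.Fin.Properties using (_≟_; toℕ-injective; toℕ-fromℕ<)
open import Data.Bool using (true; false; if_then_else_)
open import Data.List using (List; []; _∷_; _++_; [_]; reverse; length; lookup; concat; replicate)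
open import Data.List.Properties
open import Data.Product using (∃; _×_; _,_; proj₁; proj₂)
open import Data.Sum using (_⊎_; inj₁; inj₂; [_,_]′)
open import Relation.Binary.Definitions using (DecidableEquality)
open import Relation.Nullary using (¬_; yes; no; contradiction)
open import Relation.Binary.PropositionalEquality hiding ([_])

module WordFacts {A : Set} where

  equidivisible : ∀ (a b c d : List A) → a ++ b ≡ c ++ d → length a ≤ length c →
                  ∃ λ z → c ≡ a ++ z × b ≡ z ++ d
  equidivisible []      b c       d eq _ = c , refl , eq
  equidivisible (_ ∷ _) b []      d eq ()
  equidivisible (x ∷ a) b (_ ∷ c) d eq (s≤s le) with ∷-injective eq
  ... | refl , eq′ with equidivisible a b c d eq′ le
  ... | z , e₁ , e₂ = z , cong (x ∷_) e₁ , e₂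

  ++-cancel-equal-length : ∀ (a b c d : List A) → a ++ b ≡ c ++ d → length a ≡ length c →
                           a ≡ c × b ≡ d
  ++-cancel-equal-length a b c d eq la with equidivisible a b c d eq (≤-reflexive la)
  ... | [] , e₁ , e₂ = sym (trans e₁ (++-identityʳ a)) , e₂
  ... | x ∷ z , c≡axz , _ = contradiction (trans la (cong length c≡axz))
        (<⇒≢ (subst (length a <_) (sym (length-++-sucʳ a x z)) (s≤s (length-++-≤ˡ a))))

  length-snoc : ∀ (w : List A) a → length (w ++ [ a ]) ≡ suc (length w)
  length-snoc w a = trans (length-++ w) (+-comm (length w) 1)

  prefix-length : ∀ {a c : List A} → Prefix a c → length a ≤ length c
  prefix-length {a} (r , refl) = length-++-≤ˡ a

  prefix-refl : ∀ (a : List A) → Prefix a a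
  prefix-refl a = [] , ++-identityʳ a

  prefix-trans : ∀ {a b c : List A} → Prefix a b → Prefix b c → Prefix a c
  prefix-trans {a} (r , refl) (r′ , refl) = r ++ r′ , sym (++-assoc a r r′)

  prefix-comparable : ∀ {a b c : List A} → Prefix a c → Prefix b c → length a ≤ length b →
                      Prefix a b
  prefix-comparable {a} {b} (r , e) (r′ , e′) le with equidivisible a r b r′ (trans e (sym e′)) le
  ... | z , e₁ , _ = z , sym e₁

  prefix-equal-length : ∀ {a b : List A} → Prefix a b → length a ≡ length b → a ≡ b
  prefix-equal-length {a} {b} (r , e) la =
    proj₁ (++-cancel-equal-length a r b [] (trans e (sym (++-identityʳ b))) la)

  prefix-next-letter : ∀ {a c : List A} {x y : A} →
                       Prefix (a ++ [ x ]) c → Prefix (a ++ [ y ]) c → x ≡ y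
  prefix-next-letter {a} {x = x} {y} (r , e) (r′ , e′) =
    ∷-injectiveˡ (++-cancelˡ a (x ∷ r) (y ∷ r′)
      (trans (sym (++-assoc a [ x ] r)) (trans e (trans (sym e′) (++-assoc a [ y ] r′)))))

  lookup-prefix : ∀ {a c : List A} → Prefix a c → ∀ i (p : i < length a) (q : i < length c) →
                  lookup a (fromℕ< p) ≡ lookup c (fromℕ< q)
  lookup-prefix {_ ∷ _} (_ , refl) zero    _       _       = refl
  lookup-prefix {_ ∷ a} (r , refl) (suc i) (s≤s p) (s≤s q) = lookup-prefix {a} (r , refl) i p q

  lookup-common : ∀ {a b c : List A} → Prefix a c → Prefix b c →
                  ∀ i (p : i < length a) (q : i < length b) →
                  lookup a (fromℕ< p) ≡ lookup b (fromℕ< q)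
  lookup-common pa pb i p q =
    trans (lookup-prefix pa i p r) (sym (lookup-prefix pb i q r))
    where r = <-≤-trans p (prefix-length pa)

  palindrome-wrap : ∀ (z : List A) {p} → Palindrome p → Palindrome (reverse z ++ p ++ z)
  palindrome-wrap z {p} pp = begin
    reverse (reverse z ++ p ++ z)          ≡⟨ reverse-++ (reverse z) (p ++ z) ⟩
    reverse (p ++ z) ++ reverse (reverse z) ≡⟨ cong₂ _++_ (reverse-++ p z) (reverse-involutive z) ⟩
    (reverse z ++ reverse p) ++ z           ≡⟨ cong (λ q → (reverse z ++ q) ++ z) pp ⟩
    (reverse z ++ p) ++ z                   ≡⟨ ++-assoc (reverse z) p z ⟩
    reverse z ++ p ++ z                     ∎
    where open ≡-Reasoning

  palindrome-split : ∀ (w r : List A) → Palindrome (w ++ r) → length r ≤ length w →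
                     ∃ λ z → w ≡ reverse r ++ z × Palindrome z
  palindrome-split w r pal le
    with equidivisible (reverse r) (reverse w) w r (trans (sym (reverse-++ w r)) pal)
                       (subst (_≤ length w) (sym (length-reverse r)) le)
  ... | z , w≡r̃z , w̃≡zr = z , w≡r̃z , sym (++-cancelʳ r z (reverse z) (trans (sym w̃≡zr) w̃≡z̃r))
    where
    w̃≡z̃r : reverse w ≡ reverse z ++ r
    w̃≡z̃r = trans (cong reverse w≡r̃z)
              (trans (reverse-++ (reverse r) z) (cong (reverse z ++_) (reverse-involutive r)))

  palindrome-ends : ∀ {a b : A} (z : List A) → Palindrome (b ∷ z ++ [ a ]) → a ≡ b × Palindrome z
  palindrome-ends {a} {b} z pal = ∷-injectiveˡ eq , ++-cancelʳ [ a ] (reverse z) z middle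
    where
    eq : a ∷ reverse z ++ [ b ] ≡ b ∷ z ++ [ a ]
    eq = trans (sym (cong (_++ [ b ]) (reverse-++ z [ a ]))) (trans (sym (reverse-++ [ b ] (z ++ [ a ]))) pal)
    middle : reverse z ++ [ a ] ≡ z ++ [ a ]
    middle = trans (cong (λ c → reverse z ++ [ c ]) (∷-injectiveˡ eq)) (∷-injectiveʳ eq)

  palindromic-suffix : ∀ (V : List A) a r → Palindrome ((V ++ [ a ]) ++ r) → length r < length V →
                       ∃ λ z → Palindrome z × V ≡ reverse r ++ a ∷ z
  palindromic-suffix V a r pal r<V
    with palindrome-split (V ++ [ a ]) r pal (≤-trans (<⇒≤ r<V) (length-++-≤ˡ V))
  ... | Z , Va≡r̃Z , palZ
    with equidivisible (reverse r) Z V [ a ] (sym Va≡r̃Z) (subst (_≤ length V) (sym (length-reverse r)) (<⇒≤ r<V))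
  ... | [] , V≡r̃ , _ =
    contradiction (trans (cong length V≡r̃) (trans (length-++ (reverse r)) (trans (+-identityʳ _) (length-reverse r))))
                  (λ e → <-irrefl (sym e) r<V)
  ... | b ∷ z , V≡r̃bz , refl with palindrome-ends z palZ
  ...   | a≡b , palz = z , palz , subst (λ c → V ≡ reverse r ++ c ∷ z) (sym a≡b) V≡r̃bz

  palindrome-reversed : ∀ {P z : List A} {a} r → Palindrome P → Palindrome z →
                        P ≡ reverse r ++ a ∷ z → P ≡ (z ++ [ a ]) ++ r
  palindrome-reversed {P} {z} {a} r palP palz P≡r̃az = begin
    P                                  ≡⟨ sym palP ⟩
    reverse P                          ≡⟨ cong reverse P≡r̃az ⟩
    reverse (reverse r ++ a ∷ z)       ≡⟨ reverse-++ (reverse r) (a ∷ z) ⟩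
    reverse (a ∷ z) ++ reverse (reverse r) ≡⟨ cong₂ _++_ (reverse-++ [ a ] z) (reverse-involutive r) ⟩
    (reverse z ++ [ a ]) ++ r          ≡⟨ cong (λ q → (q ++ [ a ]) ++ r) palz ⟩
    (z ++ [ a ]) ++ r                  ∎
    where open ≡-Reasoning

  -- w w̃ is a palindrome beginning with w, so the palindromic closure of w has
  -- length at most 2|w|.
  closure-length-bound : ∀ {w p : List A} → IsPalClosure w p → length p ≤ length w + length w
  closure-length-bound {w} (_ , _ , minimal) =
    subst (_ ≤_) (trans (length-++ w) (cong (length w +_) (length-reverse w)))
      (minimal (w ++ reverse w) w-w̃-palindrome (reverse w , refl))
    where
    w-w̃-palindrome : Palindrome (w ++ reverse w)
    w-w̃-palindrome = subst (λ q → Palindrome (q ++ reverse w)) (reverse-involutive w)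
                       (palindrome-wrap (reverse w) {[]} refl)

  closure-unique : ∀ {w p p′ : List A} → IsPalClosure w p → IsPalClosure w p′ → p ≡ p′
  closure-unique {w} {p} {p′} cl@(palp , (r , wr≡p) , minp) cl′@(palp′ , (r′ , wr′≡p′) , minp′) =
    trans (sym wr≡p) (trans (cong (w ++_) r≡r′) wr′≡p′)
    where
    |p|≡|p′| : length p ≡ length p′
    |p|≡|p′| = ≤-antisym (minp p′ palp′ (r′ , wr′≡p′)) (minp′ p palp (r , wr≡p))
    short : ∀ {q} s → w ++ s ≡ q → length q ≤ length w + length w → length s ≤ length w
    short s refl bound = +-cancelˡ-≤ (length w) _ _ (subst (_≤ length w + length w) (length-++ w) bound)
    |r|≡|r′| : length (reverse r) ≡ length (reverse r′)
    |r|≡|r′| = trans (length-reverse r) (trans (+-cancelˡ-≡ (length w) _ _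
                 (trans (sym (length-++ w)) (trans (cong length wr≡p) (trans |p|≡|p′| (trans (cong length (sym wr′≡p′)) (length-++ w))))))
                 (sym (length-reverse r′)))
    r≡r′ : r ≡ r′
    r≡r′ with palindrome-split w r (subst Palindrome (sym wr≡p) palp) (short r wr≡p (closure-length-bound cl))
            | palindrome-split w r′ (subst Palindrome (sym wr′≡p′) palp′) (short r′ wr′≡p′ (closure-length-bound cl′))
    ... | z , w≡r̃z , _ | z′ , w≡r̃′z′ , _ =
      reverse-injective (proj₁ (++-cancel-equal-length (reverse r) z (reverse r′) z′
                                  (trans (sym w≡r̃z) w≡r̃′z′) |r|≡|r′|))

module ClosureSequence {A : Set} (_≟_ : DecidableEquality A) (y : ℕ → A) (v : ℕ → List A)
                       (v₀ : v 0 ≡ []) (closure : ∀ n → IsPalClosure (v n ++ [ y n ]) (v (suc n))) where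
  open WordFacts

  palindrome : ∀ n → Palindrome (v n)
  palindrome zero    = subst Palindrome (sym v₀) refl
  palindrome (suc n) = proj₁ (closure n)

  step-prefix : ∀ n → Prefix (v n ++ [ y n ]) (v (suc n))
  step-prefix n = proj₁ (proj₂ (closure n))

  prefix-mono : ∀ {i j} → i ≤ j → Prefix (v i) (v j)
  prefix-mono i≤j = go (≤⇒≤′ i≤j)
    where
    go : ∀ {i j} → i ≤′ j → Prefix (v i) (v j)
    go {i} (≤′-reflexive refl) = prefix-refl (v i)
    go {i} (≤′-step {j} le)    = prefix-trans (go le) (prefix-trans ([ y j ] , refl) (step-prefix j))

  length-mono : ∀ {i j} → i ≤ j → length (v i) ≤ length (v j)
  length-mono i≤j = prefix-length (prefix-mono i≤j)

  length-grows : ∀ n → n ≤ length (v n)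
  length-grows zero    = z≤n
  length-grows (suc n) = ≤-trans (s≤s (length-grows n))
    (subst (_≤ length (v (suc n))) (length-snoc (v n) (y n)) (prefix-length (step-prefix n)))

  earlier-step-prefix : ∀ {j n} → j < n → Prefix (v j ++ [ y j ]) (v n)
  earlier-step-prefix {j} j<n = prefix-trans (step-prefix j) (prefix-mono j<n)

  palindromic-prefix : ∀ n p → Palindrome p → Prefix p (v n) → ∃ λ j → j ≤ n × p ≡ v j
  palindromic-prefix zero p _ (r , e) = 0 , z≤n , trans (++-conicalˡ p r (trans e v₀)) (sym v₀)
  palindromic-prefix (suc n) p palp p⊑ with length p ≤? length (v n)
  ... | yes short with palindromic-prefix n p palp (prefix-comparable p⊑ (prefix-mono (n≤1+n n)) short)
  ...   | j , j≤n , e = j , m≤n⇒m≤1+n j≤n , e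
  palindromic-prefix (suc n) p palp p⊑ | no long =
    suc n , ≤-refl , prefix-equal-length p⊑ (≤-antisym (prefix-length p⊑) (proj₂ (proj₂ (closure n)) p palp vy⊑p))
    where
    vy⊑p : Prefix (v n ++ [ y n ]) p
    vy⊑p = prefix-comparable (step-prefix n) p⊑
             (subst (_≤ length p) (sym (length-snoc (v n) (y n))) (≰⇒> long))

  NoOccurrence : ℕ → A → Set
  NoOccurrence n a = ∀ j → j < n → y j ≢ a

  LastOccurrence : ℕ → A → ℕ → Set
  LastOccurrence n a m = m < n × y m ≡ a × (∀ j → m < j → j < n → y j ≢ a)

  last-occurrence : ∀ n a → NoOccurrence n a ⊎ ∃ (LastOccurrence n a)
  last-occurrence zero a = inj₁ λ _ ()
  last-occurrence (suc n) a with y n ≟ a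
  ... | yes yn≡a = inj₂ (n , ≤-refl , yn≡a , λ j n<j j<1+n → contradiction (s≤s⁻¹ j<1+n) (<⇒≱ n<j))
  ... | no yn≢a with last-occurrence n a
  ...   | inj₁ none = inj₁ λ j j<1+n → [ none j , (λ { refl → yn≢a }) ]′ (m≤n⇒m<n∨m≡n (s≤s⁻¹ j<1+n))
  ...   | inj₂ (m , m<n , ym≡a , after) =
    inj₂ (m , m<n⇒m<1+n m<n , ym≡a , λ j m<j j<1+n →
      [ after j m<j , (λ { refl → yn≢a }) ]′ (m≤n⇒m<n∨m≡n (s≤s⁻¹ j<1+n)))

  last-occurrence-earlier : ∀ {n a m} → LastOccurrence (suc n) a m → y n ≢ a → LastOccurrence n a m
  last-occurrence-earlier {n} (m<1+n , ym≡a , after) yn≢a with m≤n⇒m<n∨m≡n (s≤s⁻¹ m<1+n)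
  ... | inj₁ m<n = m<n , ym≡a , λ j m<j j<n → after j m<j (m<n⇒m<1+n j<n)
  ... | inj₂ refl = contradiction ym≡a yn≢a

  last-occurrence-at-end : ∀ {n a m} → LastOccurrence (suc n) a m → y n ≡ a → m ≡ n
  last-occurrence-at-end {n} (m<1+n , _ , after) yn≡a with m≤n⇒m<n∨m≡n (s≤s⁻¹ m<1+n)
  ... | inj₁ m<n = contradiction yn≡a (after n m<n ≤-refl)
  ... | inj₂ m≡n = m≡n

  -- Sufficient condition for a candidate C to be the closure (v_n y_n)^(+):
  -- C is a palindrome beginning with v_n y_n, |C| ≤ 2|v_n| + 1, and C is not
  -- longer than the palindrome v_n y_n r obtained from any palindromic
  -- suffix y_n z y_n of v_n y_n (where v_n = r̃ y_n z).
  closure-criterion : ∀ n C → Palindrome C → Prefix (v n ++ [ y n ]) C →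
    length C ≤ suc (length (v n) + length (v n)) →
    (∀ r z → Palindrome z → v n ≡ reverse r ++ y n ∷ z → length C ≤ length (v n) + suc (length r)) →
    v (suc n) ≡ C
  closure-criterion n C palC preC bound short = closure-unique (closure n) (palC , preC , minimal)
    where
    V = v n
    a = y n
    minimal : ∀ q → Palindrome q → Prefix (V ++ [ a ]) q → length C ≤ length q
    minimal q palq (r , refl) = subst (length C ≤_) (sym |Var|) bounded
      where
      |Var| : length ((V ++ [ a ]) ++ r) ≡ length V + suc (length r)
      |Var| = trans (length-++ (V ++ [ a ])) (trans (cong (_+ length r) (length-snoc V a))
                (sym (+-suc (length V) (length r))))
      bounded : length C ≤ length V + suc (length r)
      bounded with length V ≤? length r
      ... | yes V≤r = ≤-trans bound (subst (_≤ length V + suc (length r)) (+-suc (length V) (length V))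
                        (+-monoʳ-≤ (length V) (s≤s V≤r)))
      ... | no V≰r with palindromic-suffix V a r palq (≰⇒> V≰r)
      ...   | z , palz , V≡r̃az = short r z palz V≡r̃az

  earlier-occurrence : ∀ n r z → Palindrome z → v n ≡ reverse r ++ y n ∷ z →
                       ∃ λ j → j < n × y j ≡ y n × z ≡ v j
  earlier-occurrence n r z palz V≡r̃az
    with palindromic-prefix n z palz (prefix-trans ([ y n ] , refl) (r , sym V≡zar))
    where
    V≡zar : v n ≡ (z ++ [ y n ]) ++ r
    V≡zar = palindrome-reversed r (palindrome n) palz V≡r̃az
  ... | j , j≤n , z≡vj with m≤n⇒m<n∨m≡n j≤n
  ...   | inj₂ refl = contradiction (cong length z≡vj) (<⇒≢ |z|<|V|)
    where
    |z|<|V| : length z < length (v n)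
    |z|<|V| = subst (length z <_) (sym (trans (cong length V≡r̃az) (length-++ (reverse r))))
                (m≤n+m (suc (length z)) (length (reverse r)))
  ...   | inj₁ j<n = j , j<n , prefix-next-letter (earlier-step-prefix j<n) vjyn⊑V , z≡vj
    where
    vjyn⊑V : Prefix (v j ++ [ y n ]) (v n)
    vjyn⊑V = subst (λ w → Prefix (w ++ [ y n ]) (v n)) z≡vj
               (r , sym (palindrome-reversed r (palindrome n) palz V≡r̃az))

  closure-new-letter : ∀ n → NoOccurrence n (y n) → v (suc n) ≡ v n ++ y n ∷ v n
  closure-new-letter n none = closure-criterion n (V ++ a ∷ V) palC (V , ++-assoc V [ a ] V)
    (≤-reflexive (trans (length-++-sucʳ V a V) (cong suc (length-++ V))))
    λ r z palz V≡r̃az → let (j , j<n , yj≡a , _) = earlier-occurrence n r z palz V≡r̃az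
                         in contradiction yj≡a (none j j<n)
    where
    V = v n
    a = y n
    palC : Palindrome (V ++ a ∷ V)
    palC = subst (λ q → Palindrome (q ++ a ∷ V)) (palindrome n) (palindrome-wrap V {[ a ]} refl)

  closure-repeated-letter : ∀ n m → LastOccurrence n (y n) m →
                            ∀ z → v n ≡ v m ++ z → v (suc n) ≡ v n ++ z
  closure-repeated-letter n m (m<n , ym≡a , after) z V≡vmz =
    closure-criterion n (V ++ z) palC preC bound short
    where
    V = v n
    a = y n
    V≡z̃vm : V ≡ reverse z ++ v m
    V≡z̃vm = trans (sym (palindrome n)) (trans (cong reverse V≡vmz)
               (trans (reverse-++ (v m) z) (cong (reverse z ++_) (palindrome m))))
    palC : Palindrome (V ++ z)
    palC = subst Palindrome (sym (trans (cong (_++ z) V≡z̃vm) (++-assoc (reverse z) (v m) z)))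
             (palindrome-wrap z (palindrome m))
    preC : Prefix (V ++ [ a ]) (V ++ z)
    preC with earlier-step-prefix m<n
    ... | r₀ , e₀ = r₀ , trans (++-assoc V [ a ] r₀) (cong (V ++_) ar₀≡z)
      where
      ar₀≡z : a ∷ r₀ ≡ z
      ar₀≡z = trans (cong (_∷ r₀) (sym ym≡a))
                (++-cancelˡ (v m) _ _ (trans (sym (++-assoc (v m) [ y m ] r₀)) (trans e₀ V≡vmz)))
    |V| : length V ≡ length (v m) + length z
    |V| = trans (cong length V≡vmz) (length-++ (v m))
    bound : length (V ++ z) ≤ suc (length V + length V)
    bound = ≤-trans (≤-reflexive (length-++ V))
              (m≤n⇒m≤1+n (+-monoʳ-≤ (length V) (subst (length z ≤_) (sym |V|) (m≤n+m _ _))))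
    short : ∀ r z₁ → Palindrome z₁ → V ≡ reverse r ++ a ∷ z₁ → length (V ++ z) ≤ length V + suc (length r)
    short r z₁ palz₁ V≡r̃az₁ with earlier-occurrence n r z₁ palz₁ V≡r̃az₁
    ... | j , j<n , yj≡a , z₁≡vj = subst (_≤ length V + suc (length r)) (sym (length-++ V))
                                    (+-monoʳ-≤ (length V) |z|≤1+|r|)
      where
      j≤m : j ≤ m
      j≤m with m <? j
      ... | yes m<j = contradiction yj≡a (after j m<j j<n)
      ... | no m≮j = ≮⇒≥ m≮j
      |V|′ : length V ≡ length r + suc (length (v j))
      |V|′ = trans (cong length V≡r̃az₁) (trans (length-++ (reverse r))
               (cong₂ _+_ (length-reverse r) (cong (λ w → suc (length w)) z₁≡vj)))
      |z|≤1+|r| : length z ≤ suc (length r)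
      |z|≤1+|r| = +-cancelˡ-≤ (length (v m)) _ _ (begin
        length (v m) + length z       ≡⟨ sym |V| ⟩
        length V                      ≡⟨ |V|′ ⟩
        length r + suc (length (v j)) ≤⟨ +-monoʳ-≤ (length r) (s≤s (length-mono j≤m)) ⟩
        length r + suc (length (v m)) ≡⟨ +-suc (length r) (length (v m)) ⟩
        suc (length r + length (v m)) ≡⟨ cong suc (+-comm (length r) (length (v m))) ⟩
        suc (length (v m) + length r) ≡⟨ sym (+-suc (length (v m)) (length r)) ⟩
        length (v m) + suc (length r) ∎)
        where open ≤-Reasoning

if-<ᵇ-yes : ∀ {A : Set} {m n} {p q : A} → m < n → (if m <ᵇ n then p else q) ≡ p
if-<ᵇ-yes {m = m} {n} m<n with m <ᵇ n | <⇒<ᵇ m<n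
... | true | _ = refl

if-<ᵇ-no : ∀ {A : Set} {m n} {p q : A} → ¬ m < n → (if m <ᵇ n then p else q) ≡ q
if-<ᵇ-no {m = m} {n} m≮n with m <ᵇ n | <ᵇ⇒< m n
... | false | _ = refl
... | true | lt = contradiction (lt _) m≮n

mod-shift-≢ : ∀ K .{{_ : NonZero K}} n i → 0 < i → i < K → (n + i) mod K ≢ n mod K
mod-shift-≢ K n i i>0 i<K e = residue-shift-≢ (n % K) (m%n<n n K) residues-equal
  where
  residue-shift-≢ : ∀ r → r < K → (r + i) % K ≢ r
  residue-shift-≢ r r<K with r + i <? K
  ... | yes r+i<K = >⇒≢ (subst (r <_) (sym (m<n⇒m%n≡m r+i<K)) (m<m+n r i>0))
  ... | no r+i≮K = <⇒≢ (subst (_< r) (sym wrapped) below)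
    where
    K≤r+i : K ≤ r + i
    K≤r+i = ≮⇒≥ r+i≮K
    below : r + i ∸ K < r
    below = subst (r + i ∸ K <_) (m+n∸n≡m r K) (∸-monoˡ-< (+-monoʳ-< r i<K) K≤r+i)
    wrapped : (r + i) % K ≡ r + i ∸ K
    wrapped = trans (sym (m≤n⇒[n∸m]%m≡n%m K≤r+i)) (m<n⇒m%n≡m (<-trans below r<K))
  residues-equal : (n % K + i) % K ≡ n % K
  residues-equal = begin
    (n % K + i) % K       ≡⟨ cong (λ t → (n % K + t) % K) (sym (m<n⇒m%n≡m i<K)) ⟩
    (n % K + i % K) % K   ≡⟨ sym (%-distribˡ-+ n i K) ⟩
    (n + i) % K           ≡⟨ sym (toℕ-fromℕ< _) ⟩
    toℕ ((n + i) mod K)   ≡⟨ cong toℕ e ⟩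
    toℕ (n mod K)         ≡⟨ toℕ-fromℕ< _ ⟩
    n % K                 ∎
    where open ≡-Reasoning

mod-≡ : ∀ K .{{_ : NonZero K}} a b → a % K ≡ b % K → a mod K ≡ b mod K
mod-≡ K a b e = toℕ-injective (trans (toℕ-fromℕ< _) (trans e (sym (toℕ-fromℕ< _))))

module Blocks (k′ : ℕ) (d : ℕ → ℕ) (dpos : ∀ i → 1 ≤ d (suc i)) where
  K : ℕ
  K = suc (suc k′)

  open Episturmian K d

  state-step : ∀ m {b c} → state m ≡ (b , c) →
               state (suc m) ≡ (if suc c <ᵇ d b then (b , suc c) else (suc b , 0))
  state-step m e rewrite e = refl

  state-at-block-start : ∀ n → state (L n) ≡ (suc n , 0)
  state-in-block : ∀ n i → i < d (suc n) → state (L n + i) ≡ (suc n , i)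
  state-at-block-start zero = refl
  state-at-block-start (suc n) = subst (λ t → state t ≡ (suc (suc n) , 0)) last+1≡L
    (trans (state-step (L n + (d (suc n) ∸ 1)) (state-in-block n (d (suc n) ∸ 1) last<d)) (if-<ᵇ-no (<-irrefl 1+last≡d)))
    where
    1+last≡d : suc (d (suc n) ∸ 1) ≡ d (suc n)
    1+last≡d = trans (+-comm 1 _) (m∸n+n≡m (dpos n))
    last<d : d (suc n) ∸ 1 < d (suc n)
    last<d = subst (d (suc n) ∸ 1 <_) 1+last≡d ≤-refl
    last+1≡L : suc (L n + (d (suc n) ∸ 1)) ≡ L (suc n)
    last+1≡L = trans (sym (+-suc (L n) _)) (cong (L n +_) 1+last≡d)
  state-in-block n zero _ = subst (λ t → state t ≡ (suc n , 0)) (sym (+-identityʳ (L n))) (state-at-block-start n)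
  state-in-block n (suc i) i<d = subst (λ t → state t ≡ (suc n , suc i)) (sym (+-suc (L n) i))
    (trans (state-step (L n + i) (state-in-block n i (<-trans (n<1+n i) i<d))) (if-<ᵇ-yes i<d))

  letter-in-block : ∀ n i → i < d (suc n) → x (suc (L n + i)) ≡ n mod K
  letter-in-block n i i<d = cong (λ st → blockLetter (proj₁ st)) (state-in-block n i i<d)

  first-letter-of-block : ∀ n → x (suc (L n)) ≡ n mod K
  first-letter-of-block n = cong (λ st → blockLetter (proj₁ st)) (state-at-block-start n)

  Ψ-++ : ∀ a u w → Ψ a (u ++ w) ≡ Ψ a u ++ Ψ a w
  Ψ-++ a u w = concatMap-++ _ u w

  Ψ-self : ∀ a → Ψ a [ a ] ≡ [ a ]
  Ψ-self a with a ≟ a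
  ... | yes _ = refl
  ... | no a≢a = contradiction refl a≢a

  Ψ-other : ∀ a b → b ≢ a → Ψ a [ b ] ≡ a ∷ b ∷ []
  Ψ-other a b b≢a with b ≟ a
  ... | yes b≡a = contradiction b≡a b≢a
  ... | no _ = refl

  Ψ-length : ∀ a w → length w ≤ length (Ψ a w)
  Ψ-length a [] = z≤n
  Ψ-length a (b ∷ w) with b ≟ a
  ... | yes _ = s≤s (Ψ-length a w)
  ... | no _ = s≤s (m≤n⇒m≤1+n (Ψ-length a w))

  μ-length : ∀ n w → length w ≤ length (μ n w)
  μ-length zero w = ≤-refl
  μ-length (suc n) w = ≤-trans (Ψ-length (x (suc n)) w) (μ-length n _)

  μ-++ : ∀ n u w → μ n (u ++ w) ≡ μ n u ++ μ n w
  μ-++ zero u w = refl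
  μ-++ (suc n) u w = trans (cong (μ n) (Ψ-++ (x (suc n)) u w)) (μ-++ n _ _)

  ConstantRun : ℕ → ℕ → Fin K → Set
  ConstantRun m t c = ∀ i → i < t → x (suc (m + i)) ≡ c

  μ-run-self : ∀ m t c → ConstantRun m t c → μ (m + t) [ c ] ≡ μ m [ c ]
  μ-run-self m zero c _ = cong (λ q → μ q [ c ]) (+-identityʳ m)
  μ-run-self m (suc t) c run = begin
    μ (m + suc t) [ c ]                    ≡⟨ cong (λ q → μ q [ c ]) (+-suc m t) ⟩
    μ (m + t) (Ψ (x (suc (m + t))) [ c ])  ≡⟨ cong (λ a → μ (m + t) (Ψ a [ c ])) (run t ≤-refl) ⟩
    μ (m + t) (Ψ c [ c ])                  ≡⟨ cong (μ (m + t)) (Ψ-self c) ⟩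
    μ (m + t) [ c ]                        ≡⟨ μ-run-self m t c (λ i i<t → run i (m<n⇒m<1+n i<t)) ⟩
    μ m [ c ]                              ∎
    where open ≡-Reasoning

  μ-run-other : ∀ m t c ℓ → ConstantRun m t c → ℓ ≢ c →
                μ (m + t) [ ℓ ] ≡ concat (replicate t (μ m [ c ])) ++ μ m [ ℓ ]
  μ-run-other m zero c ℓ _ _ = cong (λ q → μ q [ ℓ ]) (+-identityʳ m)
  μ-run-other m (suc t) c ℓ run ℓ≢c = begin
    μ (m + suc t) [ ℓ ]                    ≡⟨ cong (λ q → μ q [ ℓ ]) (+-suc m t) ⟩
    μ (m + t) (Ψ (x (suc (m + t))) [ ℓ ])  ≡⟨ cong (λ a → μ (m + t) (Ψ a [ ℓ ])) (run t ≤-refl) ⟩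
    μ (m + t) (Ψ c [ ℓ ])                  ≡⟨ cong (μ (m + t)) (Ψ-other c ℓ ℓ≢c) ⟩
    μ (m + t) ([ c ] ++ [ ℓ ])             ≡⟨ μ-++ (m + t) [ c ] [ ℓ ] ⟩
    μ (m + t) [ c ] ++ μ (m + t) [ ℓ ]     ≡⟨ cong₂ _++_ (μ-run-self m t c run′) (μ-run-other m t c ℓ run′ ℓ≢c) ⟩
    μ m [ c ] ++ (concat (replicate t (μ m [ c ])) ++ μ m [ ℓ ])
                                           ≡⟨ sym (++-assoc (μ m [ c ]) _ _) ⟩
    concat (replicate (suc t) (μ m [ c ])) ++ μ m [ ℓ ] ∎
    where
    open ≡-Reasoning
    run′ : ConstantRun m t c
    run′ i i<t = run i (m<n⇒m<1+n i<t)

  g : ℕ → ℕ → Word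
  g n j = μ (L n) [ (j + n) mod K ]

  g-shift : ∀ n j → suc j < K → g (suc n) j ≡ concat (replicate (d (suc n)) (g n 0)) ++ g n (suc j)
  g-shift n j 1+j<K = trans (cong (λ t → μ (L (suc n)) [ t mod K ]) (+-suc j n))
    (μ-run-other (L n) (d (suc n)) (n mod K) ((suc j + n) mod K) (letter-in-block n) new-letter)
    where
    new-letter : (suc j + n) mod K ≢ n mod K
    new-letter = subst (λ t → t mod K ≢ n mod K) (+-comm n (suc j)) (mod-shift-≢ K n (suc j) (s≤s z≤n) 1+j<K)

  g-wrap : ∀ n → g (suc n) (suc k′) ≡ g n 0
  g-wrap n = trans (cong (λ t → μ (L (suc n)) [ t ]) same-letter)
                   (μ-run-self (L n) (d (suc n)) (n mod K) (letter-in-block n))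
    where
    same-letter : (suc k′ + suc n) mod K ≡ n mod K
    same-letter = mod-≡ K (suc k′ + suc n) n (trans (cong (_% K) (trans (+-suc (suc k′) n) (+-comm K n))) ([m+n]%n≡m%n n K))

  powers-none : ∀ e ws → powers e ws 0 ≡ []
  powers-none e [] = refl
  powers-none e (w ∷ ws) = refl

  -- Unrolling the recurrences for g, g_n(j) is expressed through the words
  -- s_{n-1}, s_{n-2}, … listed in hist (n ∸ 1).  If j + n ≥ K the unrolling
  -- stops at a word s_i (LateExpansion); otherwise it reaches the initial
  -- letter a_{j+n+1} (EarlyExpansion).  The case j = 0 is the definition of s_n.
  LateExpansion : ℕ → Set
  LateExpansion n = ∀ j → K ≤ j + n → j < K →
    g n j ≡ powers n (hist (n ∸ 1)) (K ∸ suc j) ++ nth (hist (n ∸ 1)) (K ∸ suc j)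

  EarlyExpansion : ℕ → Set
  EarlyExpansion n = ∀ j → j + n < K → g n j ≡ powers n (hist (n ∸ 1)) n ++ [ (j + n) mod K ]

  s-from-expansions : ∀ n → LateExpansion n → EarlyExpansion n → g n 0 ≡ s n
  s-from-expansions zero _ _ =
    cong [_] (mod-≡ K 0 (K ∸ (K ∸ K)) (sym (trans (cong (λ t → (K ∸ t) % K) (n∸n≡0 K)) (n%n≡0 K))))
  s-from-expansions (suc m) late early with suc m <? K
  ... | yes 1+m<K = trans (early 0 1+m<K) (sym (if-<ᵇ-yes 1+m<K))
  ... | no 1+m≮K = trans (late 0 (≮⇒≥ 1+m≮K) (s≤s z≤n)) (sym (if-<ᵇ-no 1+m≮K))

  early-step : ∀ n → g n 0 ≡ s n → EarlyExpansion n → EarlyExpansion (suc n)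
  early-step n gn≡sn early j j+1+n<K = begin
    g (suc n) j                                             ≡⟨ g-shift n j 1+j<K ⟩
    concat (replicate (d (suc n)) (g n 0)) ++ g n (suc j)  ≡⟨ cong₂ (λ w z → concat (replicate (d (suc n)) w) ++ z) gn≡sn
                                                                 (early (suc j) (subst (_< K) (+-suc j n) j+1+n<K)) ⟩
    concat (replicate (d (suc n)) (s n)) ++ (powers n (hist (n ∸ 1)) n ++ [ (suc j + n) mod K ])
                                                            ≡⟨ sym (++-assoc (concat (replicate (d (suc n)) (s n))) _ _) ⟩
    (concat (replicate (d (suc n)) (s n)) ++ powers n (hist (n ∸ 1)) n) ++ [ (suc j + n) mod K ]
                                                            ≡⟨ cong₂ (λ w t → w ++ [ t mod K ]) (powers-step n) (sym (+-suc j n)) ⟩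
    powers (suc n) (hist n) (suc n) ++ [ (j + suc n) mod K ] ∎
    where
    open ≡-Reasoning
    1+j<K : suc j < K
    1+j<K = ≤-<-trans (subst (suc j ≤_) (sym (+-suc j n)) (s≤s (m≤m+n j n))) j+1+n<K
    powers-step : ∀ n → concat (replicate (d (suc n)) (s n)) ++ powers n (hist (n ∸ 1)) n ≡ powers (suc n) (hist n) (suc n)
    powers-step zero = refl
    powers-step (suc n) = refl

  late-step : ∀ n → g n 0 ≡ s n → LateExpansion n → LateExpansion (suc n)
  late-step n gn≡sn late j K≤j+1+n j<K with suc j <? K
  late-step zero _ _ j K≤j+1 _ | yes 1+j<K = contradiction (subst (K ≤_) (+-comm j 1) K≤j+1) (<⇒≱ 1+j<K)
  late-step n@(suc _) gn≡sn late j K≤j+1+n _ | yes 1+j<K = begin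
    g (suc n) j                                             ≡⟨ g-shift n j 1+j<K ⟩
    concat (replicate (d (suc n)) (g n 0)) ++ g n (suc j)  ≡⟨ cong₂ (λ w z → concat (replicate (d (suc n)) w) ++ z) gn≡sn
                                                                 (late (suc j) (subst (K ≤_) (+-suc j n) K≤j+1+n) 1+j<K) ⟩
    concat (replicate (d (suc n)) (s n)) ++ (powers n (hist (n ∸ 1)) c ++ nth (hist (n ∸ 1)) c)
                                                            ≡⟨ sym (++-assoc (concat (replicate (d (suc n)) (s n))) _ _) ⟩
    powers (suc n) (hist n) (suc c) ++ nth (hist n) (suc c) ≡⟨ cong (λ t → powers (suc n) (hist n) t ++ nth (hist n) t) 1+c≡K-1-j ⟩
    powers (suc n) (hist n) (K ∸ suc j) ++ nth (hist n) (K ∸ suc j) ∎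
    where
    open ≡-Reasoning
    c = K ∸ suc (suc j)
    1+c≡K-1-j : suc c ≡ K ∸ suc j
    1+c≡K-1-j = sym (+-∸-assoc 1 1+j<K)
  late-step n gn≡sn late j _ j<K | no 1+j≮K with ≤-antisym j<K (≮⇒≥ 1+j≮K)
  ... | refl = begin
    g (suc n) (suc k′)                                      ≡⟨ g-wrap n ⟩
    g n 0                                                   ≡⟨ gn≡sn ⟩
    nth (hist n) 0                                          ≡⟨ cong (_++ nth (hist n) 0) (sym (powers-none (suc n) (hist n))) ⟩
    powers (suc n) (hist n) 0 ++ nth (hist n) 0             ≡⟨ cong (λ t → powers (suc n) (hist n) t ++ nth (hist n) t) (sym (n∸n≡0 k′)) ⟩
    powers (suc n) (hist n) (k′ ∸ k′) ++ nth (hist n) (k′ ∸ k′) ∎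
    where open ≡-Reasoning

  expansions : ∀ n → LateExpansion n × EarlyExpansion n
  expansions zero = (λ j K≤j+0 j<K → contradiction (subst (K ≤_) (+-identityʳ j) K≤j+0) (<⇒≱ j<K)) ,
                    (λ j _ → refl)
  expansions (suc n) with expansions n
  ... | late , early = late-step n gn≡sn late , early-step n gn≡sn early
    where gn≡sn = s-from-expansions n late early

  g-is-s : ∀ n → g n 0 ≡ s n
  g-is-s n = s-from-expansions n (proj₁ (expansions n)) (proj₂ (expansions n))

  s-is-h : ∀ n → s n ≡ h (L n)
  s-is-h n = trans (sym (g-is-s n)) (cong (λ c → μ (L n) [ c ]) (sym (first-letter-of-block n)))

  -- s_{n+1} = s_n^{d_{n+1}} g_n(1) with d_{n+1} ≥ 1 and g_n(1) nonempty, so |s_n| > n.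
  length-s : ∀ n → suc n ≤ length (s n)
  length-s zero = ≤-reflexive (cong length (g-is-s 0))
  length-s (suc n) = begin
    suc (suc n)                                         ≤⟨ s≤s (length-s n) ⟩
    suc (length (s n))                                  ≡⟨ +-comm 1 (length (s n)) ⟩
    length (s n) + 1                                    ≤⟨ +-mono-≤ (powers-length (d (suc n)) (dpos n)) (μ-length (L n) [ _ ]) ⟩
    length (concat (replicate (d (suc n)) (s n))) + length (g n 1)
                                                        ≡⟨ sym (length-++ (concat (replicate (d (suc n)) (s n)))) ⟩
    length (concat (replicate (d (suc n)) (s n)) ++ g n 1) ≡⟨ cong length (sym s-unfold) ⟩
    length (s (suc n))                                  ∎
    where
    open ≤-Reasoning
    s-unfold : s (suc n) ≡ concat (replicate (d (suc n)) (s n)) ++ g n 1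
    s-unfold = trans (sym (g-is-s (suc n)))
                 (trans (g-shift n 0 (s≤s (s≤s z≤n))) (cong (λ w → concat (replicate (d (suc n)) w) ++ g n 1) (g-is-s n)))
    powers-length : ∀ t → 1 ≤ t → length (s n) ≤ length (concat (replicate t (s n)))
    powers-length (suc t) _ = length-++-≤ˡ (s n)

module Limit (k′ : ℕ) (d : ℕ → ℕ) (dpos : ∀ i → 1 ≤ d (suc i)) (u : ℕ → List (Fin (suc (suc k′))))
             (u₁ : u 1 ≡ []) (closure : (n : ℕ) → 1 ≤ n → IsPalClosure (u n ++ [ Episturmian.x (suc (suc k′)) d n ]) (u (suc n))) where
  open Episturmian (suc (suc k′)) d
  open Blocks k′ d dpos
  open WordFacts

  -- Reindexing from 0: v_n = u_{n+1} is the closure sequence of y_n = x_{n+1},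
  -- and μ_n = Ψ_{y₀} ⋯ Ψ_{y_{n-1}}.
  v : ℕ → Word
  v n = u (suc n)

  y : ℕ → Fin K
  y n = x (suc n)

  open ClosureSequence _≟_ y v u₁ (λ n → closure (suc n) (s≤s z≤n))

  ImageOfLetter : ℕ → Fin K → Set
  ImageOfLetter n a = (NoOccurrence n a → μ n [ a ] ≡ v n ++ [ a ]) ×
                      (∀ m → LastOccurrence n a m → μ n [ a ] ++ v m ≡ v n)

  justin-from-image : ∀ n → ImageOfLetter n (y n) → h n ++ v n ≡ v (suc n)
  justin-from-image n (new , old) with last-occurrence n (y n)
  ... | inj₁ none = begin
    h n ++ v n               ≡⟨ cong (_++ v n) (new none) ⟩
    (v n ++ [ y n ]) ++ v n  ≡⟨ ++-assoc (v n) [ y n ] (v n) ⟩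
    v n ++ y n ∷ v n         ≡⟨ sym (closure-new-letter n none) ⟩
    v (suc n)                ∎
    where open ≡-Reasoning
  ... | inj₂ (m , occ) with prefix-mono (<⇒≤ (proj₁ occ))
  ...   | z , vmz≡vn = begin
    h n ++ v n               ≡⟨ cong (h n ++_) (sym vmz≡vn) ⟩
    h n ++ (v m ++ z)        ≡⟨ sym (++-assoc (h n) (v m) z) ⟩
    (h n ++ v m) ++ z        ≡⟨ cong (_++ z) (old m occ) ⟩
    v n ++ z                 ≡⟨ sym (closure-repeated-letter n m occ z (sym vmz≡vn)) ⟩
    v (suc n)                ∎
    where open ≡-Reasoning

  image-step : ∀ n → (∀ a → ImageOfLetter n a) → ∀ a → ImageOfLetter (suc n) a
  image-step n images a with y n ≟ a
  ... | yes refl = (λ none → contradiction refl (none n ≤-refl)) ,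
                   λ m occ → subst (λ m → μ (suc n) [ y n ] ++ v m ≡ v (suc n)) (sym (last-occurrence-at-end occ refl))
                               (trans (cong (λ w → μ n w ++ v n) (Ψ-self (y n))) (justin-from-image n (images (y n))))
  ... | no yn≢a = (λ none → begin
                     μ (suc n) [ a ]          ≡⟨ μa ⟩
                     h n ++ μ n [ a ]         ≡⟨ cong (h n ++_) (proj₁ (images a) (λ j j<n → none j (m<n⇒m<1+n j<n))) ⟩
                     h n ++ (v n ++ [ a ])    ≡⟨ sym (++-assoc (h n) (v n) [ a ]) ⟩
                     (h n ++ v n) ++ [ a ]    ≡⟨ cong (_++ [ a ]) justin ⟩
                     v (suc n) ++ [ a ]       ∎) ,
                  λ m occ → begin
                     μ (suc n) [ a ] ++ v m    ≡⟨ cong (_++ v m) μa ⟩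
                     (h n ++ μ n [ a ]) ++ v m ≡⟨ ++-assoc (h n) (μ n [ a ]) (v m) ⟩
                     h n ++ (μ n [ a ] ++ v m) ≡⟨ cong (h n ++_) (proj₂ (images a) m (last-occurrence-earlier occ yn≢a)) ⟩
                     h n ++ v n                ≡⟨ justin ⟩
                     v (suc n)                 ∎
    where
    open ≡-Reasoning
    justin : h n ++ v n ≡ v (suc n)
    justin = justin-from-image n (images (y n))
    μa : μ (suc n) [ a ] ≡ h n ++ μ n [ a ]
    μa = trans (cong (μ n) (Ψ-other (y n) a (λ a≡yn → yn≢a (sym a≡yn)))) (μ-++ n [ y n ] [ a ])

  images : ∀ n a → ImageOfLetter n a
  images zero a = (λ _ → cong (_++ [ a ]) (sym u₁)) , λ m ()
  images (suc n) = image-step n (images n)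

  justin : ∀ n → h n ++ v n ≡ v (suc n)
  justin n = justin-from-image n (images n (y n))

  -- The common limit: position i is fixed once |v_{i+1}| > i.
  t : ℕ → Fin K
  t i = lookup (v (suc i)) (fromℕ< (length-grows (suc i)))

  u-converges : IsLimit u t
  u-converges i = suc (suc i) , λ { (suc n) (s≤s i+1≤n) →
    let i<|vn| = <-≤-trans (length-grows (suc i)) (length-mono i+1≤n)
    in i<|vn| , sym (lookup-prefix (prefix-mono i+1≤n) i (length-grows (suc i)) i<|vn|) }

  -- s_n = h_{L_n} is a prefix of v_{L_n + 1}, hence of all later v_m.
  s-converges : IsLimit s t
  s-converges i = i , λ n i≤n →
    let i<|sn| = <-≤-trans (s≤s i≤n) (length-s n)
        N = suc i + suc (L n)
        sn⊑vN = prefix-trans (subst (λ w → Prefix w (v (suc (L n)))) (sym (s-is-h n)) (v (L n) , justin (L n)))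
                             (prefix-mono (m≤n+m (suc (L n)) (suc i)))
    in i<|sn| , lookup-common sn⊑vN (prefix-mono (m≤m+n (suc i) (suc (L n)))) i i<|sn| (length-grows (suc i))

proposition3p2 : (k : ℕ) {{nz : NonZero k}} → 2 ≤ k → (d : ℕ → ℕ) → (∀ i → 1 ≤ d (suc i)) →
    ((n : ℕ) → 1 ≤ n → Episturmian.s k d n ≡ Episturmian.h k d (Episturmian.L k d n))
    × ((u : ℕ → List (Fin k)) → u 1 ≡ [] →
       ((n : ℕ) → 1 ≤ n → IsPalClosure (u n ++ [ Episturmian.x k d n ]) (u (suc n))) →
       ∃ λ (t : ℕ → Fin k) → IsLimit u t × IsLimit (Episturmian.s k d) t)
proposition3p2 (suc zero) (s≤s ()) _ _
proposition3p2 (suc (suc k′)) _ d dpos =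
  (λ n _ → Blocks.s-is-h k′ d dpos n) ,
  λ u u₁ closure → let open Limit k′ d dpos u u₁ closure in t , u-converges , s-converges
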